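{- Let $T$ be a finite tree with $n$ vertices. Then either (C1) $T$ has a central vertex $c$ and every connected component of $T-\{c\}$ has at most $n/3$ vertices; or there are two distinct vertices $u,v$ of $T$ such that (C2) every connected component of $T-\{u,v\}$ has at most $n/3$ vertices, and (C2') after deleting the edges of the path from $u$ to $v$ in $T$, the connected component $T_u$ containing $u$ and the connected component $T_v$ containing $v$ each have more than $n/3$ vertices.
   Context: A central vertex of a tree $T$ with $n$ vertices is a vertex $c$ such that every connected component of $T-\{c\}$ has strictly fewer than $n/2$ vertices (if it exists, it is unique; a tree in which some edge splits it into two parts of exactly $n/2$ vertices each has no central vertex). -}

module Defs where

open import Data.Nat using (ℕ; _*_; _≤_; _<_)
open import Data.Fin using (Fin)
open import Data.Bool using (Bool; T)
open import Data.List using (List; []; _∷_; length)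
open import Data.List.Relation.Unary.Unique.Propositional using (Unique)
open import Data.Fin.Subset using (Subset; _∈_; ∣_∣)
open import Data.Product using (Σ; ∃; ∃-syntax; _×_; _,_)
open import Data.Sum using (_⊎_)
open import Data.Empty using (⊥)
open import Relation.Nullary using (¬_)
open import Relation.Binary.PropositionalEquality using (_≡_; _≢_)
open import Function.Bundles using (_⇔_)

record Graph (n : ℕ) : Set where
  field
    adj   : Fin n → Fin n → Bool
    sym   : ∀ x y → T (adj x y) → T (adj y x)
    irrefl : ∀ x → ¬ T (adj x x)

  Adj : Fin n → Fin n → Set
  Adj x y = T (adj x y)

data Walk {n : ℕ} (R : Fin n → Fin n → Set) : Fin n → Fin n → Set where
  []  : ∀ {x} → Walk R x x
  _∷_ : ∀ {x y z} → R x y → Walk R y z → Walk R x z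

verts : ∀ {n} {R : Fin n → Fin n → Set} {x y : Fin n} → Walk R x y → List (Fin n)
verts {x = x} []      = x ∷ []
verts {x = x} (e ∷ w) = x ∷ verts w

IsPath : ∀ {n} {R : Fin n → Fin n → Set} {x y : Fin n} → Walk R x y → Set
IsPath w = Unique (verts w)

Step : ∀ {n} {R : Fin n → Fin n → Set} {x y : Fin n} → Walk R x y → Fin n → Fin n → Set
Step [] a b = ⊥
Step {x = x} (_∷_ {y = y} e w) a b = (a ≡ x × b ≡ y) ⊎ Step w a b

EdgeOf : ∀ {n} {R : Fin n → Fin n → Set} {x y : Fin n} → Walk R x y → Fin n → Fin n → Set
EdgeOf w a b = Step w a b ⊎ Step w b a

module _ {n : ℕ} (G : Graph n) where
  open Graph G

  Connected : Set
  Connected = ∀ x y → Walk Adj x y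

  HasCycle : Set
  HasCycle = Σ (Fin n) λ x → Σ (Fin n) λ y → Σ (Walk Adj x y) λ w →
               IsPath w × 3 ≤ length (verts w) × Adj y x

  IsTree : Set
  IsTree = 1 ≤ n × Connected × ¬ HasCycle

  AdjMinus : (Fin n → Set) → Fin n → Fin n → Set
  AdjMinus S a b = Adj a b × ¬ S a × ¬ S b

  IsComponentMinus : (Fin n → Set) → Fin n → Subset n → Set
  IsComponentMinus S x C = ¬ S x × (∀ y → (y ∈ C) ⇔ Walk (AdjMinus S) x y)

  AllComponentsMinus : (Fin n → Set) → (ℕ → Set) → Set
  AllComponentsMinus S P = ∀ x C → IsComponentMinus S x C → P ∣ C ∣

  AdjWithoutEdges : ∀ {u v} → Walk Adj u v → Fin n → Fin n → Set
  AdjWithoutEdges w a b = Adj a b × ¬ EdgeOf w a b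

  IsComponentWithoutEdges : ∀ {u v} → Walk Adj u v → Fin n → Subset n → Set
  IsComponentWithoutEdges w x C = ∀ y → (y ∈ C) ⇔ Walk (AdjWithoutEdges w) x y

  IsCentral : Fin n → Set
  IsCentral c = AllComponentsMinus (λ y → y ≡ c) (λ k → 2 * k < n)

-- Call the branch at a towards a neighbour b, the component of T - a containing b, heavy if it
-- has more than n/3 vertices. Stepping from a heavy branch into a heavy branch that leads further
-- away strictly decreases branch size, so we reach an edge a u whose branch at a towards u is
-- heavy while all other branches at u are light. If the branch at u towards a is light too, u
-- satisfies (C1). Otherwise descend once more, from u towards a, to an edge a′ v of the same kind.
-- The heavy branches at a towards u and at a′ towards v are disjoint, so a component of
-- T - {u, v} outside both has fewer than n/3 vertices, and every other component lies in a light
-- branch (C2); neither heavy branch contains an edge of the u–v path, whence (C2′).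
module Submission where

open import Defs
open import Data.Empty using (⊥-elim)
open import Data.Fin using (Fin; zero; suc; _≟_; fromℕ<)
open import Data.Fin.Properties using (any?; injective⇒≤)
open import Data.Fin.Subset using (Subset; _∈_; _∉_; _⊆_; _∪_; ∣_∣; inside; outside)
open import Data.Fin.Subset.Properties using (∣p∣≤n; x∈p∪q⁻; p⊆q⇒∣p∣≤∣q∣; p⊂q⇒∣p∣<∣q∣)
open import Data.List using (List; _∷_; length; lookup)
open import Data.List.Membership.Propositional using () renaming (_∈_ to _∈ₗ_)
open import Data.List.Membership.Propositional.Properties using (∈-lookup)
open import Data.List.Relation.Unary.All as All using (All; []; _∷_)
open import Data.List.Relation.Unary.All.Properties using (¬Any⇒All¬)
open import Data.List.Relation.Unary.AllPairs using ([]; _∷_)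
open import Data.List.Relation.Unary.Any using (here; there)
open import Data.List.Relation.Unary.Unique.Propositional using (Unique)
open import Data.Nat using (ℕ; zero; suc; _+_; _*_; _≤_; _<_; z≤n; s≤s)
open import Data.Nat.Induction using (<-wellFounded)
open import Data.Nat.Properties hiding (_≟_)
open import Data.Nat.Tactic.RingSolver using (solve-∀)
open import Data.Product using (Σ; ∃; ∃₂; _×_; _,_; proj₁)
open import Data.Sum using (_⊎_; inj₁; inj₂; [_,_]′)
open import Data.Vec using (tabulate; _∷_; []; here; there)
open import Data.Vec.Properties using (lookup∘tabulate; []=⇒lookup; lookup⇒[]=)
open import Function using (_∘_; id)
open import Function.Bundles using (Equivalence)
open import Induction.WellFounded using (Acc; acc)
open import Level using (0ℓ)
open import Relation.Binary.Core using (Rel)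
open import Relation.Binary.PropositionalEquality using (_≡_; _≢_; refl; sym; trans; cong; subst)
open import Relation.Nullary using (Dec; yes; no; ¬_; does)
open import Relation.Nullary.Decidable using (T?; dec-true; _×-dec_; _⊎-dec_; ¬?)

module _ {n : ℕ} {P : Fin n → Set} (P? : ∀ x → Dec (P x)) where

  toSubset : Subset n
  toSubset = tabulate (does ∘ P?)

  ∈-toSubset⁺ : ∀ {x} → P x → x ∈ toSubset
  ∈-toSubset⁺ {x} px = lookup⇒[]= x toSubset (trans (lookup∘tabulate _ x) (dec-true (P? x) px))

  ∈-toSubset⁻ : ∀ {x} → x ∈ toSubset → P x
  ∈-toSubset⁻ {x} x∈ with P? x | trans (sym (lookup∘tabulate (does ∘ P?) x)) ([]=⇒lookup x∈)
  ... | yes px | _ = px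
  ... | no _   | ()

disjoint-∷⁻ : ∀ {n s t} {p q : Subset n} → (∀ {x} → x ∈ s ∷ p → x ∉ t ∷ q) → ∀ {x} → x ∈ p → x ∉ q
disjoint-∷⁻ disj x∈p x∈q = disj (there x∈p) (there x∈q)

∣∪∣-disjoint : ∀ {n} (p q : Subset n) → (∀ {x} → x ∈ p → x ∉ q) → ∣ p ∪ q ∣ ≡ ∣ p ∣ + ∣ q ∣
∣∪∣-disjoint []            []            _    = refl
∣∪∣-disjoint (outside ∷ p) (outside ∷ q) disj = ∣∪∣-disjoint p q (disjoint-∷⁻ disj)
∣∪∣-disjoint (outside ∷ p) (inside ∷ q)  disj =
  trans (cong suc (∣∪∣-disjoint p q (disjoint-∷⁻ disj))) (sym (+-suc ∣ p ∣ ∣ q ∣))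
∣∪∣-disjoint (inside ∷ p)  (outside ∷ q) disj = cong suc (∣∪∣-disjoint p q (disjoint-∷⁻ disj))
∣∪∣-disjoint (inside ∷ p)  (inside ∷ q)  disj = ⊥-elim (disj here here)

∣p∣+∣q∣+∣r∣≤n : ∀ {n} (p q r : Subset n) → (∀ {x} → x ∈ p → x ∉ q) → (∀ {x} → x ∈ p → x ∉ r) →
                (∀ {x} → x ∈ q → x ∉ r) → ∣ p ∣ + ∣ q ∣ + ∣ r ∣ ≤ n
∣p∣+∣q∣+∣r∣≤n {n} p q r p#q p#r q#r = begin
  ∣ p ∣ + ∣ q ∣ + ∣ r ∣ ≡⟨ cong (_+ ∣ r ∣) (∣∪∣-disjoint p q p#q) ⟨
  ∣ p ∪ q ∣ + ∣ r ∣     ≡⟨ ∣∪∣-disjoint (p ∪ q) r pq#r ⟨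
  ∣ (p ∪ q) ∪ r ∣       ≤⟨ ∣p∣≤n ((p ∪ q) ∪ r) ⟩
  n                     ∎
  where
  open ≤-Reasoning
  pq#r : ∀ {x} → x ∈ p ∪ q → x ∉ r
  pq#r x∈p∪q with x∈p∪q⁻ p q x∈p∪q
  ... | inj₁ x∈p = p#r x∈p
  ... | inj₂ x∈q = q#r x∈q

third-of-rest : ∀ {c s t n} → c + s + t ≤ n → n < 3 * s → n < 3 * t → 3 * c ≤ n
third-of-rest {c} {s} {t} {n} total s-heavy t-heavy =
  ≤-trans (m≤m+n (3 * c) 2) (+-cancelʳ-≤ (2 * n) (3 * c + 2) n bound)
  where
  open ≤-Reasoning
  regroup : ∀ c n → 3 * c + 2 + 2 * n ≡ 3 * c + (suc n + suc n)
  regroup = solve-∀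
  factor : ∀ c s t → 3 * c + (3 * s + 3 * t) ≡ 3 * (c + s + t)
  factor = solve-∀
  bound : 3 * c + 2 + 2 * n ≤ n + 2 * n
  bound = begin
    3 * c + 2 + 2 * n         ≡⟨ regroup c n ⟩
    3 * c + (suc n + suc n)   ≤⟨ +-monoʳ-≤ (3 * c) (+-mono-≤ s-heavy t-heavy) ⟩
    3 * c + (3 * s + 3 * t)   ≡⟨ factor c s t ⟩
    3 * (c + s + t)           ≤⟨ *-monoʳ-≤ 3 total ⟩
    3 * n                     ≡⟨⟩
    n + 2 * n                 ∎

third⇒half : ∀ {k n} → 1 ≤ n → 3 * k ≤ n → 2 * k < n
third⇒half {zero}  n≥1 _     = n≥1
third⇒half {suc k} _   third = ≤-trans (s≤s (m≤n+m (2 * suc k) k)) third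

lookup-injective : ∀ {n} {xs : List (Fin n)} → Unique xs → ∀ i j → lookup xs i ≡ lookup xs j → i ≡ j
lookup-injective (_ ∷ _)       zero    zero    _  = refl
lookup-injective (x∉xs ∷ _)    zero    (suc j) eq = ⊥-elim (All.lookup x∉xs (∈-lookup j) eq)
lookup-injective (x∉xs ∷ _)    (suc i) zero    eq = ⊥-elim (All.lookup x∉xs (∈-lookup i) (sym eq))
lookup-injective (_ ∷ unique) (suc i) (suc j) eq = cong suc (lookup-injective unique i j eq)

length-unique≤ : ∀ {n} {xs : List (Fin n)} → Unique xs → length xs ≤ n
length-unique≤ unique = injective⇒≤ (λ {i} {j} → lookup-injective unique i j)

module _ {n : ℕ} where

  private
    Vertex = Fin n

  open import Data.List.Membership.DecPropositional (_≟_ {n}) using () renaming (_∈?_ to _∈ₗ?_)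

  mapʷ : ∀ {R S : Rel Vertex 0ℓ} → (∀ {p q} → R p q → S p q) → ∀ {x y} → Walk R x y → Walk S x y
  mapʷ f []      = []
  mapʷ f (e ∷ w) = f e ∷ mapʷ f w

  verts-mapʷ : ∀ {R S : Rel Vertex 0ℓ} (f : ∀ {p q} → R p q → S p q) {x y} (w : Walk R x y) →
               verts (mapʷ f w) ≡ verts w
  verts-mapʷ f []      = refl
  verts-mapʷ f (e ∷ w) = cong (_ ∷_) (verts-mapʷ f w)

  infixr 5 _++ʷ_
  _++ʷ_ : ∀ {R : Rel Vertex 0ℓ} {x y z} → Walk R x y → Walk R y z → Walk R x z
  []      ++ʷ v = v
  (e ∷ w) ++ʷ v = e ∷ (w ++ʷ v)

  infixl 5 _∷ʳʷ_
  _∷ʳʷ_ : ∀ {R : Rel Vertex 0ℓ} {x y z} → Walk R x y → R y z → Walk R x z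
  w ∷ʳʷ e = w ++ʷ (e ∷ [])

  reverseʷ : ∀ {R : Rel Vertex 0ℓ} → (∀ {p q} → R p q → R q p) → ∀ {x y} → Walk R x y → Walk R y x
  reverseʷ sym []      = []
  reverseʷ sym (e ∷ w) = reverseʷ sym w ∷ʳʷ sym e

  lengthʷ : ∀ {R : Rel Vertex 0ℓ} {x y} → Walk R x y → ℕ
  lengthʷ []      = 0
  lengthʷ (e ∷ w) = suc (lengthʷ w)

  length-verts : ∀ {R : Rel Vertex 0ℓ} {x y} (w : Walk R x y) → length (verts w) ≡ suc (lengthʷ w)
  length-verts []      = refl
  length-verts (e ∷ w) = cong suc (length-verts w)

  lengthʷ-path< : ∀ {R : Rel Vertex 0ℓ} {x y} (w : Walk R x y) → IsPath w → lengthʷ w < n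
  lengthʷ-path< w path = subst (_≤ n) (length-verts w) (length-unique≤ path)

  suffix : ∀ {R : Rel Vertex 0ℓ} {x y z} (w : Walk R y z) → IsPath w → x ∈ₗ verts w → Σ (Walk R x z) IsPath
  suffix []      path       (here refl) = [] , path
  suffix (e ∷ w) path       (here refl) = e ∷ w , path
  suffix (e ∷ w) (_ ∷ path) (there x∈w) = suffix w path x∈w

  toPath : ∀ {R : Rel Vertex 0ℓ} {x y} → Walk R x y → Σ (Walk R x y) IsPath
  toPath []                = [] , ([] ∷ [])
  toPath {x = x} (e ∷ w) with toPath w
  ... | p , path with x ∈ₗ? verts p
  ...   | yes x∈p = suffix p path x∈p
  ...   | no  x∉p = e ∷ p , (¬Any⇒All¬ _ x∉p ∷ path)

  walkOfLength≤? : ∀ {R : Rel Vertex 0ℓ} → (∀ x y → Dec (R x y)) → ∀ k x y →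
                   Dec (Σ (Walk R x y) λ w → lengthʷ w ≤ k)
  walkOfLength≤? R? k x y with x ≟ y
  ... | yes refl = yes ([] , z≤n)
  walkOfLength≤? R? zero x y | no x≢y = no λ { ([] , _) → x≢y refl ; ((_ ∷ _) , ()) }
  walkOfLength≤? R? (suc k) x y | no x≢y with any? (λ z → R? x z ×-dec walkOfLength≤? R? k z y)
  ... | yes (z , e , w , len≤k) = yes (e ∷ w , s≤s len≤k)
  ... | no ∄ = no λ { ([] , _) → x≢y refl ; (_∷_ {y = z} e w , s≤s len≤k) → ∄ (z , e , w , len≤k) }

  -- Searching walks of at most n steps suffices: every walk shortens to a path, and paths have fewer than n steps.
  walk? : ∀ {R : Rel Vertex 0ℓ} → (∀ x y → Dec (R x y)) → ∀ x y → Dec (Walk R x y)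
  walk? R? x y with walkOfLength≤? R? n x y
  ... | yes (w , _) = yes w
  ... | no ∄ = no λ w → let (p , path) = toPath w in ∄ (p , <⇒≤ (lengthʷ-path< p path))

  Avoiding : (Vertex → Set) → Rel Vertex 0ℓ → Rel Vertex 0ℓ
  Avoiding S R p q = R p q × ¬ S p × ¬ S q

  avoids-end : ∀ {S : Vertex → Set} {R : Rel Vertex 0ℓ} {x y} → Walk (Avoiding S R) x y → ¬ S x → ¬ S y
  avoids-end []                 ¬Sx = ¬Sx
  avoids-end ((_ , _ , ¬Sq) ∷ w) _ = avoids-end w ¬Sq

  stayOrExit : ∀ {S : Vertex → Set} {R : Rel Vertex 0ℓ} → (∀ x → Dec (S x)) → ∀ {x y} → Walk R x y → ¬ S x →
               Walk (Avoiding S R) x y ⊎ ∃₂ λ z s → Walk (Avoiding S R) x z × R z s × S s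
  stayOrExit S? []                     ¬Sx = inj₁ []
  stayOrExit S? (_∷_ {y = x₁} e w) ¬Sx with S? x₁
  ... | yes Sx₁ = inj₂ (_ , x₁ , [] , e , Sx₁)
  ... | no ¬Sx₁ with stayOrExit S? w ¬Sx₁
  ...   | inj₁ w′                     = inj₁ ((e , ¬Sx , ¬Sx₁) ∷ w′)
  ...   | inj₂ (z , s , w′ , e′ , Ss) = inj₂ (z , s , (e , ¬Sx , ¬Sx₁) ∷ w′ , e′ , Ss)

  firstEntry : ∀ {S : Vertex → Set} {R : Rel Vertex 0ℓ} → (∀ x → Dec (S x)) → ∀ {x y} → Walk R x y → ¬ S x → S y →
               ∃₂ λ z s → Walk (Avoiding S R) x z × R z s × S s
  firstEntry S? w ¬Sx Sy with stayOrExit S? w ¬Sx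
  ... | inj₁ w′   = ⊥-elim (avoids-end w′ ¬Sx Sy)
  ... | inj₂ exit = exit

  avoiding-weaken : ∀ {S S′ : Vertex → Set} {R : Rel Vertex 0ℓ} → (∀ {v} → S′ v → S v) →
                    ∀ {x y} → Walk (Avoiding S R) x y → Walk (Avoiding S′ R) x y
  avoiding-weaken S′⊆S = mapʷ λ { (e , ¬Sp , ¬Sq) → e , ¬Sp ∘ S′⊆S , ¬Sq ∘ S′⊆S }

  avoids-verts : ∀ {S : Vertex → Set} {R : Rel Vertex 0ℓ} {x y} (w : Walk (Avoiding S R) x y) → ¬ S x →
                 All (λ v → ¬ S v) (verts w)
  avoids-verts []                 ¬Sx = ¬Sx ∷ []
  avoids-verts ((_ , _ , ¬Sq) ∷ w) ¬Sx = ¬Sx ∷ avoids-verts w ¬Sq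

  start∈verts : ∀ {R : Rel Vertex 0ℓ} {x y} (w : Walk R x y) → x ∈ₗ verts w
  start∈verts []      = here refl
  start∈verts (_ ∷ _) = here refl

  end∈verts : ∀ {R : Rel Vertex 0ℓ} {x y} (w : Walk R x y) → y ∈ₗ verts w
  end∈verts []      = here refl
  end∈verts (_ ∷ w) = there (end∈verts w)

  step-target∈verts : ∀ {R : Rel Vertex 0ℓ} {x y p q} (w : Walk R x y) → Step w p q → q ∈ₗ verts w
  step-target∈verts (_ ∷ w) (inj₁ (_ , refl)) = there (start∈verts w)
  step-target∈verts (_ ∷ w) (inj₂ s)          = there (step-target∈verts w s)

module Branches {n : ℕ} (G : Graph n) where

  open Graph G renaming (sym to adj-sym)

  adj? : ∀ x y → Dec (Adj x y)
  adj? x y = T? (adj x y)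

  Adj⇒≢ : ∀ {x y} → Adj x y → x ≢ y
  Adj⇒≢ {x} x~y refl = irrefl x x~y

  Minus : Fin n → Fin n → Fin n → Set
  Minus a = AdjMinus G (λ y → y ≡ a)

  minus? : ∀ a x y → Dec (Minus a x y)
  minus? a x y = adj? x y ×-dec ¬? (x ≟ a) ×-dec ¬? (y ≟ a)

  minus-sym : ∀ {a x y} → Minus a x y → Minus a y x
  minus-sym (x~y , x≢a , y≢a) = adj-sym _ _ x~y , y≢a , x≢a

  Branch : Fin n → Fin n → Fin n → Set
  Branch a b y = Walk (Minus a) b y

  branch : Fin n → Fin n → Subset n
  branch a b = toSubset (walk? (minus? a) b)

  size : Fin n → Fin n → ℕ
  size a b = ∣ branch a b ∣

  a∉Branch[a,b] : ∀ {a b} → Adj a b → ¬ Branch a b a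
  a∉Branch[a,b] a~b w = avoids-end w (Adj⇒≢ a~b ∘ sym) refl

  branch-of : Connected G → ∀ {a x} → x ≢ a → ∃ λ z → Adj a z × Branch a z x
  branch-of conn {a} x≢a with firstEntry (_≟ a) (conn _ a) x≢a refl
  ... | z , _ , w , z~a , refl = z , adj-sym z a z~a , reverseʷ minus-sym w

  via-neighbour : ∀ {S : Fin n → Set} {a b y z} → (∀ {v} → v ≡ b → S v) → a ≢ b → Adj z a →
                  Walk (AdjMinus G S) y z → ¬ S y → Branch b a y
  via-neighbour b∈S a≢b z~a w y∉S =
    (adj-sym _ _ z~a , a≢b , avoids-end w y∉S ∘ b∈S) ∷ reverseʷ minus-sym (avoiding-weaken b∈S w)

  branch-cover : Connected G → ∀ {a b} → Adj a b → ∀ y → Branch a b y ⊎ Branch b a y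
  branch-cover conn {a} {b} a~b y with y ≟ a | y ≟ b
  ... | yes refl | _        = inj₂ []
  ... | no _     | yes refl = inj₁ []
  ... | no y≢a   | no y≢b with firstEntry (λ v → v ≟ a ⊎-dec v ≟ b) (conn y a) [ y≢a , y≢b ]′ (inj₁ refl)
  ...   | _ , _ , w , z~a , inj₁ refl = inj₂ (via-neighbour inj₂ (Adj⇒≢ a~b) z~a w [ y≢a , y≢b ]′)
  ...   | _ , _ , w , z~b , inj₂ refl = inj₁ (via-neighbour inj₁ (Adj⇒≢ a~b ∘ sym) z~b w [ y≢a , y≢b ]′)

  minus-forget : ∀ {a b x y} → Walk (Avoiding (_≡ a) (Minus b)) x y → Walk (Minus a) x y
  minus-forget = mapʷ λ { ((x~y , _) , x≢a , y≢a) → x~y , x≢a , y≢a }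

  ∈branch⁺ : ∀ {a b y} → Branch a b y → y ∈ branch a b
  ∈branch⁺ = ∈-toSubset⁺ (walk? (minus? _) _)

  ∈branch⁻ : ∀ {a b y} → y ∈ branch a b → Branch a b y
  ∈branch⁻ = ∈-toSubset⁻ (walk? (minus? _) _)

  path-from-targets : ∀ {u a v} (P : Walk Adj u v) → IsPath P → Branch u a v → ∀ {p q} → Step P p q → Branch u a q
  path-from-targets {u} {a} (e ∷ Q) (u∉Q ∷ _) v∈B step = target step
    where
    verts-in-branch : ∀ {s t} (Q : Walk Adj s t) → All (u ≢_) (verts Q) → Branch u a t → All (Branch u a) (verts Q)
    verts-in-branch []      _                t∈B = t∈B ∷ []
    verts-in-branch (e ∷ Q) (u≢s ∷ u∉Q) t∈B = (next∈B ∷ʳʷ (adj-sym _ _ e , u≢next ∘ sym , u≢s ∘ sym)) ∷ inQ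
      where
      inQ : All (Branch u a) (verts Q)
      inQ = verts-in-branch Q u∉Q t∈B
      next∈B : Branch u a _
      next∈B = All.lookup inQ (start∈verts Q)
      u≢next : u ≢ _
      u≢next = All.lookup u∉Q (start∈verts Q)

    target : ∀ {p q} → Step (e ∷ Q) p q → Branch u a q
    target (inj₁ (_ , refl)) = All.lookup (verts-in-branch Q u∉Q v∈B) (start∈verts Q)
    target (inj₂ s)          = All.lookup (verts-in-branch Q u∉Q v∈B) (step-target∈verts Q s)

  path-to-sources : ∀ {v a u} → Adj v a → (P : Walk Adj u v) → IsPath P → Branch v a u →
                    ∀ {p q} → Step P p q → Branch v a p
  path-to-sources     v~a (_ ∷ _)        _                  u∈B (inj₁ (refl , _)) = u∈B
  path-to-sources {v} v~a (e ∷ (e′ ∷ Q)) (_ ∷ (s∉Q ∷ path)) u∈B (inj₂ step) =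
    path-to-sources v~a (e′ ∷ Q) (s∉Q ∷ path) (u∈B ∷ʳʷ (e , u≢v , All.lookup s∉Q (end∈verts Q))) step
    where
    u≢v : _ ≢ v
    u≢v = avoids-end u∈B (Adj⇒≢ v~a ∘ sym)

  component⊆branch : Connected G → ∀ {S : Fin n → Set} {u x C} → S u → IsComponentMinus G S x C →
                     ∃ λ z → Adj u z × Branch u z x × C ⊆ branch u z
  component⊆branch conn {S} Su (¬Sx , C⇔) with branch-of conn (λ x≡u → ¬Sx (subst S (sym x≡u) Su))
  ... | z , u~z , x∈B = z , u~z , x∈B , λ y∈C →
    ∈branch⁺ (x∈B ++ʷ avoiding-weaken (λ { refl → Su }) (Equivalence.to (C⇔ _) y∈C))

module TreeBranches {n : ℕ} (G : Graph n) (acyclic : ¬ HasCycle G) where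

  open Graph G renaming (sym to adj-sym)
  open Branches G

  neighbours-separated : ∀ {a x y} → Adj a x → Adj a y → x ≢ y → ¬ Walk (Minus a) x y
  neighbours-separated {a} {x} {y} a~x a~y x≢y w with toPath w
  ... | [] , _ = x≢y refl
  ... | p@(_ ∷ p′) , path = acyclic (a , y , a~x ∷ mapʷ proj₁ p , cycle-path , cycle-length , adj-sym a y a~y)
    where
    a∉p : All (a ≢_) (verts p)
    a∉p = All.map (_∘ sym) (avoids-verts p (Adj⇒≢ a~x ∘ sym))
    cycle-path : Unique (a ∷ verts (mapʷ proj₁ p))
    cycle-path = subst (λ vs → Unique (a ∷ vs)) (sym (verts-mapʷ proj₁ p)) (a∉p ∷ path)
    cycle-length : 3 ≤ length (a ∷ verts (mapʷ proj₁ p))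
    cycle-length = s≤s (s≤s (subst (1 ≤_) (sym (length-verts (mapʷ proj₁ p′))) (s≤s z≤n)))

  branches-disjoint : ∀ {a b y} → Adj a b → Branch a b y → ¬ Branch b a y
  branches-disjoint {a} {b} a~b y∈Bab y∈Bba
    with firstEntry (_≟ a) (reverseʷ minus-sym y∈Bba) (avoids-end y∈Bab (Adj⇒≢ a~b ∘ sym)) refl
  ... | z , _ , y→z , (z~a , z≢b , _) , refl =
    neighbours-separated a~b (adj-sym z a z~a) (z≢b ∘ sym)
      (y∈Bab ++ʷ minus-forget y→z)

  branch-⊆ : ∀ {a b c y} → Adj a b → Adj b c → c ≢ a → Branch b c y → Branch a b y
  branch-⊆ {a} {b} {c} a~b b~c c≢a y∈Bbc with stayOrExit (_≟ a) y∈Bbc c≢a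
  ... | inj₁ c→y = (b~c , Adj⇒≢ a~b ∘ sym , c≢a) ∷ minus-forget c→y
  ... | inj₂ (z , _ , c→z , z→a , refl) =
    ⊥-elim (neighbours-separated b~c (adj-sym a b a~b) c≢a (mapʷ proj₁ c→z ∷ʳʷ z→a))

  size-decreasing : ∀ {a b c} → Adj a b → Adj b c → c ≢ a → size b c < size a b
  size-decreasing a~b b~c c≢a =
    p⊂q⇒∣p∣<∣q∣ ((∈branch⁺ ∘ branch-⊆ a~b b~c c≢a ∘ ∈branch⁻) , _ , ∈branch⁺ [] , a∉Branch[a,b] b~c ∘ ∈branch⁻)

module Balanced {n : ℕ} (G : Graph n) (conn : Connected G) (acyclic : ¬ HasCycle G) where

  open Graph G renaming (sym to adj-sym)
  open Branches G
  open TreeBranches G acyclic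

  AtMostThird : ℕ → Set
  AtMostThird k = 3 * k ≤ n

  Heavy : Fin n → Fin n → Set
  Heavy a b = n < 3 * size a b

  heavy? : ∀ a b → Dec (Heavy a b)
  heavy? a b = n <? 3 * size a b

  LightBeyond : Fin n → Fin n → Set
  LightBeyond a u = ∀ c → Adj u c → c ≢ a → AtMostThird (size u c)

  HeavyEnd : Fin n → Fin n → Set
  HeavyEnd a b = ∃₂ λ a′ u → Adj a′ u × Heavy a′ u × LightBeyond a′ u × (∀ {y} → Branch a′ u y → Branch a b y)

  heavy-descent : ∀ {a b} → Adj a b → Heavy a b → HeavyEnd a b
  heavy-descent = descend (<-wellFounded _)
    where
    descend : ∀ {a b} → Acc _<_ (size a b) → Adj a b → Heavy a b → HeavyEnd a b
    descend {a} {b} (acc smaller) a~b heavy with any? (λ c → adj? b c ×-dec ¬? (c ≟ a) ×-dec heavy? b c)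
    ... | yes (c , b~c , c≢a , heavy′) with descend (smaller (size-decreasing a~b b~c c≢a)) b~c heavy′
    ...   | a′ , u , a′~u , heavy-end , light , within = a′ , u , a′~u , heavy-end , light , branch-⊆ a~b b~c c≢a ∘ within
    descend {a} {b} (acc _) a~b heavy | no none =
      a , b , a~b , heavy , (λ c b~c c≢a → ≮⇒≥ λ heavy′ → none (c , b~c , c≢a , heavy′)) , id

  third-of-component : ∀ {S : Fin n → Set} {u x C} → S u → IsComponentMinus G S x C →
                       (∀ z → Adj u z → Branch u z x → AtMostThird (size u z)) → AtMostThird ∣ C ∣
  third-of-component Su comp light with component⊆branch conn Su comp
  ... | z , u~z , x∈B , C⊆B = ≤-trans (*-monoʳ-≤ 3 (p⊆q⇒∣p∣≤∣q∣ C⊆B)) (light z u~z x∈B)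

  ThirdCentre : Fin n → Set
  ThirdCentre c = IsCentral G c × AllComponentsMinus G (λ y → y ≡ c) AtMostThird

  ThirdPair : Fin n → Fin n → Set
  ThirdPair u v = u ≢ v × AllComponentsMinus G (λ y → y ≡ u ⊎ y ≡ v) AtMostThird ×
                  (∀ (P : Walk Adj u v) → IsPath P →
                     (∀ C → IsComponentWithoutEdges G P u C → n < 3 * ∣ C ∣) ×
                     (∀ C → IsComponentWithoutEdges G P v C → n < 3 * ∣ C ∣))

  third-centre : 1 ≤ n → ∀ {c} → (∀ z → Adj c z → AtMostThird (size c z)) → ThirdCentre c
  third-centre n≥1 {c} light = (λ x C comp → third⇒half {∣ C ∣} n≥1 (third x C comp)) , third
    where
    third : AllComponentsMinus G (λ y → y ≡ c) AtMostThird
    third _ _ comp = third-of-component refl comp (λ z c~z _ → light z c~z)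

  third-beyond : ∀ {S : Fin n → Set} {a u x C} → Adj a u → LightBeyond a u → S u →
                 IsComponentMinus G S x C → Branch a u x → AtMostThird ∣ C ∣
  third-beyond {a = a} {u} {x} a~u light Su comp x∈Bau = third-of-component Su comp light-or-towards-a
    where
    light-or-towards-a : ∀ z → Adj u z → Branch u z x → AtMostThird (size u z)
    light-or-towards-a z u~z x∈Buz with z ≟ a
    ... | yes refl = ⊥-elim (branches-disjoint a~u x∈Bau x∈Buz)
    ... | no z≢a   = light z u~z z≢a

  branch⊆component : ∀ {a b u v C} {P : Walk Adj u v} → Adj a b →
                     (∀ {p q} → EdgeOf P p q → Branch b a p ⊎ Branch b a q) →
                     IsComponentWithoutEdges G P b C → branch a b ⊆ C
  branch⊆component {a} {b} {P = P} a~b edges C⇔ y∈B = Equivalence.from (C⇔ _) (keep [] (∈branch⁻ y∈B))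
    where
    keep : ∀ {p y} → Branch a b p → Walk (Minus a) p y → Walk (AdjWithoutEdges G P) p y
    keep _   []                     = []
    keep p∈B (e@(p~q , _ , _) ∷ w) = (p~q , [ branches-disjoint a~b p∈B , branches-disjoint a~b q∈B ]′ ∘ edges)
                                     ∷ keep q∈B w
      where
      q∈B : Branch a b _
      q∈B = p∈B ∷ʳʷ e

  light-everywhere : ∀ {a u} → LightBeyond a u → AtMostThird (size u a) → ∀ z → Adj u z → AtMostThird (size u z)
  light-everywhere {a} light light-a z u~z with z ≟ a
  ... | yes refl = light-a
  ... | no z≢a   = light z u~z z≢a

  heavy-⊆ : ∀ {p q : Subset n} → n < 3 * ∣ p ∣ → p ⊆ q → n < 3 * ∣ q ∣
  heavy-⊆ heavy p⊆q = <-≤-trans heavy (*-monoʳ-≤ 3 (p⊆q⇒∣p∣≤∣q∣ p⊆q))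

  module TwoCentres {a u a′ v} (a~u : Adj a u) (heavy-u : Heavy a u) (light-u : LightBeyond a u)
                    (a′~v : Adj a′ v) (heavy-v : Heavy a′ v) (light-v : LightBeyond a′ v)
                    (v-side : ∀ {y} → Branch a′ v y → Branch u a y) where

    u≢v : u ≢ v
    u≢v refl = a∉Branch[a,b] (adj-sym a u a~u) (v-side [])

    u∈Branch[v,a′] : Branch v a′ u
    u∈Branch[v,a′] with branch-cover conn a′~v u
    ... | inj₁ u∈Ba′v = ⊥-elim (a∉Branch[a,b] (adj-sym a u a~u) (v-side u∈Ba′v))
    ... | inj₂ u∈Bva′ = u∈Bva′

    components-third : AllComponentsMinus G (λ y → y ≡ u ⊎ y ≡ v) AtMostThird
    components-third x C comp@(_ , C⇔) with branch-cover conn a~u x | branch-cover conn a′~v x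
    ... | inj₁ x∈Bau | _           = third-beyond a~u light-u (inj₁ refl) comp x∈Bau
    ... | inj₂ _     | inj₁ x∈Ba′v = third-beyond a′~v light-v (inj₂ refl) comp x∈Ba′v
    ... | inj₂ x∈Bua | inj₂ x∈Bva′ =
      third-of-rest {∣ C ∣} (∣p∣+∣q∣+∣r∣≤n C (branch a u) (branch a′ v) C#Bau C#Ba′v Bau#Ba′v) heavy-u heavy-v
      where
      reach : ∀ {y} → y ∈ C → Walk (AdjMinus G (λ y → y ≡ u ⊎ y ≡ v)) x y
      reach = Equivalence.to (C⇔ _)
      C#Bau : ∀ {y} → y ∈ C → y ∉ branch a u
      C#Bau y∈C y∈B = branches-disjoint a~u (∈branch⁻ y∈B) (x∈Bua ++ʷ avoiding-weaken inj₁ (reach y∈C))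
      C#Ba′v : ∀ {y} → y ∈ C → y ∉ branch a′ v
      C#Ba′v y∈C y∈B = branches-disjoint a′~v (∈branch⁻ y∈B) (x∈Bva′ ++ʷ avoiding-weaken inj₂ (reach y∈C))
      Bau#Ba′v : ∀ {y} → y ∈ branch a u → y ∉ branch a′ v
      Bau#Ba′v y∈Bau y∈Ba′v = branches-disjoint a~u (∈branch⁻ y∈Bau) (v-side (∈branch⁻ y∈Ba′v))

    sides-heavy : ∀ (P : Walk Adj u v) → IsPath P →
                  (∀ C → IsComponentWithoutEdges G P u C → n < 3 * ∣ C ∣) ×
                  (∀ C → IsComponentWithoutEdges G P v C → n < 3 * ∣ C ∣)
    sides-heavy P path = (λ _ comp → heavy-⊆ heavy-u (branch⊆component a~u u-edges comp))
                       , (λ _ comp → heavy-⊆ heavy-v (branch⊆component a′~v v-edges comp))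
      where
      target : ∀ {p q} → Step P p q → Branch u a q
      target = path-from-targets P path (v-side [])
      source : ∀ {p q} → Step P p q → Branch v a′ p
      source = path-to-sources (adj-sym a′ v a′~v) P path u∈Branch[v,a′]
      u-edges : ∀ {p q} → EdgeOf P p q → Branch u a p ⊎ Branch u a q
      u-edges = [ inj₂ ∘ target , inj₁ ∘ target ]′
      v-edges : ∀ {p q} → EdgeOf P p q → Branch v a′ p ⊎ Branch v a′ q
      v-edges = [ inj₁ ∘ source , inj₂ ∘ source ]′

    third-pair : ThirdPair u v
    third-pair = u≢v , components-third , sides-heavy

  separation : 1 ≤ n → Σ (Fin n) ThirdCentre ⊎ Σ (Fin n) λ u → Σ (Fin n) λ v → ThirdPair u v
  separation n≥1 with any? (λ c → adj? (fromℕ< n≥1) c ×-dec heavy? (fromℕ< n≥1) c)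
  ... | no none = inj₁ (_ , third-centre n≥1 λ z r~z → ≮⇒≥ λ heavy → none (z , r~z , heavy))
  ... | yes (_ , r~c , heavy) with heavy-descent r~c heavy
  ...   | a , u , a~u , heavy-u , light-u , _ with heavy? u a
  ...     | no light-ua = inj₁ (u , third-centre n≥1 (light-everywhere light-u (≮⇒≥ light-ua)))
  ...     | yes heavy-ua with heavy-descent (adj-sym a u a~u) heavy-ua
  ...       | a′ , v , a′~v , heavy-v , light-v , v-side =
    inj₂ (u , v , TwoCentres.third-pair a~u heavy-u light-u a′~v heavy-v light-v v-side)

lemma1 : (n : ℕ) (T : Graph n) → IsTree T →
    (Σ (Fin n) λ c → IsCentral T c
       × AllComponentsMinus T (λ y → y ≡ c) (λ k → 3 * k ≤ n))
    ⊎
    (Σ (Fin n) λ u → Σ (Fin n) λ v → u ≢ v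
       × AllComponentsMinus T (λ y → y ≡ u ⊎ y ≡ v) (λ k → 3 * k ≤ n)
       × (∀ (P : Walk (Graph.Adj T) u v) → IsPath P →
            (∀ C → IsComponentWithoutEdges T P u C → n < 3 * ∣ C ∣)
          × (∀ C → IsComponentWithoutEdges T P v C → n < 3 * ∣ C ∣)))
lemma1 _ T (n≥1 , conn , acyclic) = Balanced.separation T conn acyclic n≥1
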